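{- Let $\mathcal{R}_1\subseteq\mathcal{R}$ be transfer systems on $L$. There is a bijection $\Psi$ from the set of join-irreducible elements of the interval $[\mathcal{R}_1,\mathcal{R}]$ to the set of non-trivial relations in $\mathcal{R}$ that lift on the left every relation of $\mathcal{R}_1$, mapping $\mathcal{R}'$ to $(a,b)$, where $(a,b)$ is the join label of $\mathcal{R}'_*\lessdot\mathcal{R}'$. Moreover, $\mathcal{R}'=\mathcal{R}_1\vee\operatorname{Tr}(a,b)$ and $\mathcal{R}'_*=\mathcal{R}'\wedge\{(x,y): (a,b)\text{ lifts on the left }(x,y)\}$.
   Context: $L$ is a finite lattice. A transfer system on $L$ is a subposet $\lhd$ of $\leq$ such that $x\lhd y$ and $w\leq y$ imply $x\wedge w\lhd w$; they form a lattice $\operatorname{Trs}(L)$ under inclusion. A relation $(a,b)$ lifts on the left $(x,y)$ if whenever $a\leq x$ and $b\leq y$ we have $b\leq x$. $\operatorname{Tr}(a,b)$ is the smallest transfer system containing $(a,b)$. $\mathcal{R}'_*$ is the unique element of $[\mathcal{R}_1,\mathcal{R}]$ covered by the join-irreducible $\mathcal{R}'$ of the interval; the join label of a cover $\mathcal{T}\lessdot\mathcal{S}$ is the unique non-trivial relation of $\mathcal{S}$ lifting on the left every relation of $\mathcal{T}$. -}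

module Defs where

open import Level using (0ℓ)
open import Data.Nat using (ℕ)
open import Data.Fin using (Fin)
open import Data.Bool using (Bool; T)
open import Data.Product using (Σ; _×_; _,_)
open import Data.Sum using (_⊎_)
open import Relation.Nullary using (¬_)
open import Relation.Binary using (Rel; Decidable)
open import Relation.Binary.PropositionalEquality using (_≡_)
open import Relation.Binary.Lattice.Structures using (IsLattice)
open import Algebra.Core using (Op₂)

record FiniteLattice : Set₁ where
  field
    n         : ℕ
    _≤_       : Rel (Fin n) 0ℓ
    _≤?_      : Decidable _≤_
    _∨_       : Op₂ (Fin n)
    _∧_       : Op₂ (Fin n)
    isLattice : IsLattice _≡_ _≤_ _∨_ _∧_

module _ (L : FiniteLattice) where
  open FiniteLattice L

  Elt : Set
  Elt = Fin n

  BRel : Set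
  BRel = Elt → Elt → Bool

  Holds : BRel → Elt → Elt → Set
  Holds R x y = T (R x y)

  _⊆_ : BRel → BRel → Set
  R ⊆ S = ∀ x y → Holds R x y → Holds S x y

  _≐_ : BRel → BRel → Set
  R ≐ S = R ⊆ S × S ⊆ R

  record IsTransferSystem (R : BRel) : Set where
    field
      sub    : ∀ x y → Holds R x y → x ≤ y
      refl   : ∀ x → Holds R x x
      trans  : ∀ x y z → Holds R x y → Holds R y z → Holds R x z
      restr  : ∀ x y w → Holds R x y → w ≤ y → Holds R (x ∧ w) w

  LiftsLeft : Elt → Elt → Elt → Elt → Set
  LiftsLeft a b x y = a ≤ x → b ≤ y → b ≤ x

  LiftsAll : Elt → Elt → BRel → Set
  LiftsAll a b S = ∀ x y → Holds S x y → LiftsLeft a b x y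

  IsJoinTrs : BRel → BRel → BRel → Set
  IsJoinTrs S T J = IsTransferSystem J × S ⊆ J × T ⊆ J
    × (∀ U → IsTransferSystem U → S ⊆ U → T ⊆ U → J ⊆ U)

  IsTr : Elt → Elt → BRel → Set
  IsTr a b T' = IsTransferSystem T' × Holds T' a b
    × (∀ U → IsTransferSystem U → Holds U a b → T' ⊆ U)

  module Interval (R₁ R : BRel) where
    InI : BRel → Set
    InI S = IsTransferSystem S × R₁ ⊆ S × S ⊆ R

    IsJoinI : BRel → BRel → BRel → Set
    IsJoinI S T J = InI J × S ⊆ J × T ⊆ J
      × (∀ U → InI U → S ⊆ U → T ⊆ U → J ⊆ U)

    JoinIrr : BRel → Set
    JoinIrr J = InI J × ¬ (J ≐ R₁)
      × (∀ S T → InI S → InI T → IsJoinI S T J → (J ≐ S) ⊎ (J ≐ T))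

    Covers : BRel → BRel → Set
    Covers S J = InI S × InI J × S ⊆ J × ¬ (J ⊆ S)
      × (∀ U → InI U → S ⊆ U → U ⊆ J → (U ≐ S) ⊎ (U ≐ J))

  IsLabelCandidate : BRel → BRel → Elt → Elt → Set
  IsLabelCandidate S J a b = Holds J a b × ¬ (a ≡ b) × LiftsAll a b S

  IsJoinLabel : BRel → BRel → Elt → Elt → Set
  IsJoinLabel S J a b = IsLabelCandidate S J a b
    × (∀ c d → IsLabelCandidate S J c d → (c , d) ≡ (a , b))

  -- For a join-irreducible J of [R₁ , R] and (a,b) = Ψ(J):
  -- (a,b) is a non-trivial relation of R lifting on the left all of R₁;
  -- J has a unique lower cover J_* in [R₁ , R], (a,b) is the join label of J_* ⋖ J,
  -- J_* = J ∩ {(x,y) : (a,b) lifts on the left (x,y)}, and J = R₁ ∨ Tr(a,b).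
  module _ (R₁ R : BRel) where
    open Interval R₁ R

    InTarget : Elt → Elt → Set
    InTarget a b = Holds R a b × ¬ (a ≡ b) × LiftsAll a b R₁

    PsiSpec : BRel → Elt → Elt → Set
    PsiSpec J a b = InTarget a b
      × Σ BRel (λ Jₛ →
          Covers Jₛ J
          × (∀ K → Covers K J → K ≐ Jₛ)
          × IsJoinLabel Jₛ J a b
          × (∀ x y → (Holds Jₛ x y → Holds J x y × LiftsLeft a b x y)
                   × (Holds J x y × LiftsLeft a b x y → Holds Jₛ x y)))
      × Σ BRel (λ T' → IsTr a b T' × IsJoinTrs R₁ T' J)

{-# OPTIONS --safe #-}
-- For a non-trivial relation (a , b) of J lifting every relation of R₁, let J₋ be the
-- part of J that (a , b) lifts on the left. If (a , b) fails to lift (x , y) ∈ K for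
-- some K strictly below R₁ ∨ Tr(a,b) in the interval, restricting (x , y) to b gives
-- (a , b) ∈ K, which is absurd; so every such K lies in J₋, and R₁ ∨ Tr(a,b) is
-- join-irreducible with unique lower cover J₋ and join label (a , b).
-- Conversely, for a join-irreducible J choose such an (a , b) lexicographically
-- maximal. An upper bound U of R₁ ∨ Tr(a,b) and J₋ that misses a relation of J also
-- misses one lifting every relation of U; (a , b) cannot lift it, so it is a
-- lexicographically larger candidate. Hence J = (R₁ ∨ Tr(a,b)) ∨ J₋ in the interval,
-- and as (a , b) ∉ J₋, join-irreducibility forces J = R₁ ∨ Tr(a,b).
module Submission where

open import Defs
open import Data.Product using (Σ; _×_; _,_; proj₁; proj₂; ∃; ∃₂; uncurry)
open import Relation.Binary.PropositionalEquality
  using (_≡_; refl; sym; trans; cong; subst; module ≡-Reasoning)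

open import Level using (0ℓ)
open import Function.Base using (flip; _∘_)
open import Data.Empty using (⊥-elim)
open import Data.Fin using (_≟_)
open import Data.Fin.Properties using (any?; all?)
open import Data.Fin.Induction using (po-wellFounded; po-noetherian)
open import Data.Product.Relation.Binary.Lex.Strict using (×-Lex; ×-wellFounded; ×-decidable)
open import Data.Sum using (_⊎_; inj₁; inj₂; [_,_]′)
open import Induction.WellFounded using (WellFounded; Acc; acc)
open import Relation.Binary using (Rel; Decidable)
open import Relation.Binary.Lattice.Bundles using (MeetSemilattice)
open import Relation.Binary.Lattice.Structures using (IsLattice)
import Relation.Binary.Lattice.Properties.MeetSemilattice as MeetSemilatticeProperties
import Relation.Binary.Construct.NonStrictToStrict as NonStrictToStrict
open import Relation.Nullary using (¬_; Dec; yes; no)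
open import Relation.Nullary.Decidable
  using (T?; ¬?; _×-dec_; _⊎-dec_; _→-dec_; isYes; toWitness; fromWitness; decidable-stable; map′)

module _ {A : Set} {_>_ : Rel A 0ℓ} (>-wellFounded : WellFounded _>_) {P : A → Set}
         (above? : ∀ x → Dec (∃ λ y → y > x × P y)) where

  ∃-maximal : ∀ {x} → P x → ∃ λ m → P m × (∀ y → y > m → ¬ P y)
  ∃-maximal {x} = go (>-wellFounded x)
    where
    go : ∀ {x} → Acc _>_ x → P x → ∃ λ m → P m × (∀ y → y > m → ¬ P y)
    go {x} (acc higher) Px with above? x
    ... | yes (y , y>x , Py) = go (higher y>x) Py
    ... | no none = x , Px , λ y y>x Py → none (y , y>x , Py)

module TransferSystems (L : FiniteLattice) where
  open FiniteLattice L
  open IsLattice isLattice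
    using (isPartialOrder; isMeetSemilattice; antisym; x∧y≤x; x∧y≤y; ∧-greatest)
    renaming (refl to ≤-refl; trans to ≤-trans)
  open NonStrictToStrict _≡_ _≤_ using (_<_)
  module TS = IsTransferSystem

  meetSemilattice : MeetSemilattice 0ℓ 0ℓ 0ℓ
  meetSemilattice = record
    { _≈_ = _≡_ ; _≤_ = _≤_ ; _∧_ = _∧_ ; isMeetSemilattice = isMeetSemilattice }

  open MeetSemilatticeProperties meetSemilattice using (∧-comm; ∧-assoc; y≤x⇒x∧y≈y)

  x≤y⇒x∧y≡x : ∀ {x y} → x ≤ y → x ∧ y ≡ x
  x≤y⇒x∧y≡x {x} {y} x≤y = trans (∧-comm x y) (y≤x⇒x∧y≈y x≤y)

  x≤y⇒x∧[y∧z]≡x∧z : ∀ {x y} z → x ≤ y → x ∧ (y ∧ z) ≡ x ∧ z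
  x≤y⇒x∧[y∧z]≡x∧z {x} {y} z x≤y = begin
    x ∧ (y ∧ z)  ≡⟨ sym (∧-assoc x y z) ⟩
    (x ∧ y) ∧ z  ≡⟨ cong (_∧ z) (x≤y⇒x∧y≡x x≤y) ⟩
    x ∧ z        ∎
    where open ≡-Reasoning

  z≤y⇒[x∧y]∧z≡x∧z : ∀ x {y z} → z ≤ y → (x ∧ y) ∧ z ≡ x ∧ z
  z≤y⇒[x∧y]∧z≡x∧z x {y} {z} z≤y = begin
    (x ∧ y) ∧ z  ≡⟨ ∧-assoc x y z ⟩
    x ∧ (y ∧ z)  ≡⟨ cong (x ∧_) (y≤x⇒x∧y≈y z≤y) ⟩
    x ∧ z        ∎
    where open ≡-Reasoning

  infix 4 _⟨_⟩_ _⊑_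

  _⟨_⟩_ : Elt L → BRel L → Elt L → Set
  x ⟨ S ⟩ y = Holds L S x y

  _⊑_ : BRel L → BRel L → Set
  _⊑_ = _⊆_ L

  holds? : (S : BRel L) → Decidable (λ x y → x ⟨ S ⟩ y)
  holds? S x y = T? (S x y)

  _⊑?_ : (S U : BRel L) → Dec (S ⊑ U)
  S ⊑? U = all? λ x → all? λ y → holds? S x y →-dec holds? U x y

  any²? : {P : Elt L × Elt L → Set} → (∀ p → Dec (P p)) → Dec (∃ P)
  any²? P? = map′ (λ (x , y , Pxy) → (x , y) , Pxy) (λ ((x , y) , Pxy) → x , y , Pxy)
    (any? λ x → any? λ y → P? (x , y))

  counterexample : {P Q : Rel (Elt L) 0ℓ} → Decidable P → Decidable Q →
    ¬ (∀ x y → P x y → Q x y) → ∃₂ λ x y → P x y × ¬ Q x y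
  counterexample P? Q? ¬P⇒Q with any? (λ x → any? λ y → P? x y ×-dec ¬? (Q? x y))
  ... | yes found = found
  ... | no none = ⊥-elim (¬P⇒Q λ x y Pxy →
          decidable-stable (Q? x y) λ ¬Qxy → none (x , y , Pxy , ¬Qxy))

  ⋢⇒counterexample : ∀ {S U} → ¬ S ⊑ U → ∃₂ λ x y → x ⟨ S ⟩ y × ¬ x ⟨ U ⟩ y
  ⋢⇒counterexample {S} {U} = counterexample (holds? S) (holds? U)

  ⌊_⌋ʳ : {P : Rel (Elt L) 0ℓ} → Decidable P → BRel L
  ⌊ P? ⌋ʳ x y = isYes (P? x y)

  module _ {P : Rel (Elt L) 0ℓ} (P? : Decidable P) {x y : Elt L} where

    ⌊⌋ʳ⁺ : P x y → x ⟨ ⌊ P? ⌋ʳ ⟩ y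
    ⌊⌋ʳ⁺ = fromWitness

    ⌊⌋ʳ⁻ : x ⟨ ⌊ P? ⌋ʳ ⟩ y → P x y
    ⌊⌋ʳ⁻ = toWitness

  LiftsLeft? : ∀ a b → Decidable (LiftsLeft L a b)
  LiftsLeft? a b x y = a ≤? x →-dec (b ≤? y →-dec b ≤? x)

  ¬LiftsLeft⇒ : ∀ {a b x y} → ¬ LiftsLeft L a b x y → a ≤ x × b ≤ y × ¬ b ≤ x
  ¬LiftsLeft⇒ {a} {b} {x} {y} ¬lift with a ≤? x | b ≤? y
  ... | yes a≤x | yes b≤y = a≤x , b≤y , λ b≤x → ¬lift λ _ _ → b≤x
  ... | yes _   | no b≰y  = ⊥-elim (¬lift λ _ b≤y → ⊥-elim (b≰y b≤y))
  ... | no a≰x  | _       = ⊥-elim (¬lift λ a≤x → ⊥-elim (a≰x a≤x))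

  LiftsAll? : ∀ a b S → Dec (LiftsAll L a b S)
  LiftsAll? a b S = all? λ x → all? λ y → holds? S x y →-dec LiftsLeft? a b x y

  ¬LiftsAll⇒counterexample : ∀ {a b S} → ¬ LiftsAll L a b S →
    ∃₂ λ x y → x ⟨ S ⟩ y × ¬ LiftsLeft L a b x y
  ¬LiftsAll⇒counterexample {a} {b} {S} = counterexample (holds? S) (LiftsLeft? a b)

  ¬self-lifting : ∀ {a b} → a ≤ b → ¬ a ≡ b → ¬ LiftsLeft L a b a b
  ¬self-lifting a≤b a≢b lift = a≢b (antisym a≤b (lift ≤-refl ≤-refl))

  module _ {S : BRel L} (S-isTS : IsTransferSystem L S) where
    open IsTransferSystem S-isTS using (sub; restr)

    ⟨⟩-trans : ∀ {x y z} → x ⟨ S ⟩ y → y ⟨ S ⟩ z → x ⟨ S ⟩ z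
    ⟨⟩-trans = TS.trans S-isTS _ _ _

    ∉⇒≢ : ∀ {x y} → ¬ x ⟨ S ⟩ y → ¬ x ≡ y
    ∉⇒≢ {x} ¬xSy refl = ¬xSy (TS.refl S-isTS x)

    restrict-≤ : ∀ {x y w} → x ⟨ S ⟩ y → x ≤ w → w ≤ y → x ⟨ S ⟩ w
    restrict-≤ {x} {y} {w} xSy x≤w w≤y =
      subst (_⟨ S ⟩ w) (x≤y⇒x∧y≡x x≤w) (restr x y w xSy w≤y)

    restrict-∧ : ∀ {x u} w → x ⟨ S ⟩ u → (x ∧ w) ⟨ S ⟩ (u ∧ w)
    restrict-∧ {x} {u} w xSu = subst (_⟨ S ⟩ (u ∧ w)) (x≤y⇒x∧[y∧z]≡x∧z w (sub x u xSu))
      (restr x u (u ∧ w) xSu (x∧y≤x u w))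

    -- A relation (p , q) of U that (x , y) fails to lift moves the counterexample
    -- down to (x , p ∧ y), which is still in S but not in U.
    liftingCounterexample : ∀ {U} → IsTransferSystem L U → ∀ {x y} →
      x ⟨ S ⟩ y → ¬ x ⟨ U ⟩ y → ∃₂ λ x' y' → x' ⟨ S ⟩ y' × ¬ x' ⟨ U ⟩ y' × LiftsAll L x' y' U
    liftingCounterexample {U} U-isTS {x} {y} = go (po-wellFounded isPartialOrder y)
      where
      go : ∀ {y} → Acc _<_ y → x ⟨ S ⟩ y → ¬ x ⟨ U ⟩ y →
        ∃₂ λ x' y' → x' ⟨ S ⟩ y' × ¬ x' ⟨ U ⟩ y' × LiftsAll L x' y' U
      go {y} (acc smaller) xSy ¬xUy with LiftsAll? x y U
      ... | yes lifts = x , y , xSy , ¬xUy , lifts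
      ... | no ¬lifts with ¬LiftsAll⇒counterexample ¬lifts
      ... | p , q , pUq , ¬lift with ¬LiftsLeft⇒ ¬lift
      ... | x≤p , y≤q , y≰p =
        go (smaller p∧y<y) (restrict-≤ xSy (∧-greatest x≤p (sub x y xSy)) (x∧y≤y p y)) ¬xU[p∧y]
        where
        p∧y<y : p ∧ y < y
        p∧y<y = x∧y≤y p y , λ p∧y≡y → y≰p (subst (_≤ p) p∧y≡y (x∧y≤x p y))
        ¬xU[p∧y] : ¬ x ⟨ U ⟩ (p ∧ y)
        ¬xU[p∧y] xU = ¬xUy (TS.trans U-isTS _ _ _ xU (TS.restr U-isTS p q y pUq y≤q))

  TrStep : Elt L → Elt L → Rel (Elt L) 0ℓ
  TrStep a b x y = x ≡ y ⊎ (y ≤ b × x ≡ a ∧ y)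

  TrStep? : ∀ a b → Decidable (TrStep a b)
  TrStep? a b x y = x ≟ y ⊎-dec (y ≤? b ×-dec x ≟ a ∧ y)

  Tr : Elt L → Elt L → BRel L
  Tr a b = ⌊ TrStep? a b ⌋ʳ

  module _ (a b : Elt L) where

    Tr⁺ : ∀ {x y} → TrStep a b x y → x ⟨ Tr a b ⟩ y
    Tr⁺ = ⌊⌋ʳ⁺ (TrStep? a b)

    Tr⁻ : ∀ {x y} → x ⟨ Tr a b ⟩ y → TrStep a b x y
    Tr⁻ = ⌊⌋ʳ⁻ (TrStep? a b)

    Tr-sub : ∀ x y → x ⟨ Tr a b ⟩ y → x ≤ y
    Tr-sub x y xy with Tr⁻ xy
    ... | inj₁ refl = ≤-refl
    ... | inj₂ (_ , refl) = x∧y≤y a y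

    Tr-trans : ∀ x y z → x ⟨ Tr a b ⟩ y → y ⟨ Tr a b ⟩ z → x ⟨ Tr a b ⟩ z
    Tr-trans x y z xy yz with Tr⁻ xy | Tr⁻ yz
    ... | inj₁ refl       | _                 = yz
    ... | inj₂ _          | inj₁ refl         = xy
    ... | inj₂ (_ , refl) | inj₂ (z≤b , refl) = Tr⁺ (inj₂ (z≤b , x≤y⇒x∧[y∧z]≡x∧z z ≤-refl))

    Tr-restr : ∀ x y w → x ⟨ Tr a b ⟩ y → w ≤ y → (x ∧ w) ⟨ Tr a b ⟩ w
    Tr-restr x y w xy w≤y with Tr⁻ xy
    ... | inj₁ refl = Tr⁺ (inj₁ (y≤x⇒x∧y≈y w≤y))
    ... | inj₂ (y≤b , refl) = Tr⁺ (inj₂ (≤-trans w≤y y≤b , z≤y⇒[x∧y]∧z≡x∧z a w≤y))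

    Tr-isTransferSystem : IsTransferSystem L (Tr a b)
    Tr-isTransferSystem = record
      { sub = Tr-sub ; refl = λ _ → Tr⁺ (inj₁ refl) ; trans = Tr-trans ; restr = Tr-restr }

    Tr-minimal : ∀ {U} → IsTransferSystem L U → a ⟨ U ⟩ b → Tr a b ⊑ U
    Tr-minimal U-isTS aUb x y xy with Tr⁻ xy
    ... | inj₁ refl = TS.refl U-isTS x
    ... | inj₂ (y≤b , refl) = TS.restr U-isTS a b y aUb y≤b

    Tr-∋ : a ≤ b → a ⟨ Tr a b ⟩ b
    Tr-∋ a≤b = Tr⁺ (inj₂ (≤-refl , sym (x≤y⇒x∧y≡x a≤b)))

    Tr-isTr : a ≤ b → IsTr L a b (Tr a b)
    Tr-isTr a≤b = Tr-isTransferSystem , Tr-∋ a≤b , λ _ → Tr-minimal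

  LiftedByStep? : ∀ J a b → Decidable (λ x y → x ⟨ J ⟩ y × LiftsLeft L a b x y)
  LiftedByStep? J a b x y = holds? J x y ×-dec LiftsLeft? a b x y

  LiftedBy : BRel L → Elt L → Elt L → BRel L
  LiftedBy J a b = ⌊ LiftedByStep? J a b ⌋ʳ

  module LiftedByProperties (J : BRel L) (a b : Elt L) where

    LiftedBy⁺ : ∀ {x y} → x ⟨ J ⟩ y → LiftsLeft L a b x y → x ⟨ LiftedBy J a b ⟩ y
    LiftedBy⁺ xJy lift = ⌊⌋ʳ⁺ (LiftedByStep? J a b) (xJy , lift)

    LiftedBy⁻ : ∀ {x y} → x ⟨ LiftedBy J a b ⟩ y → x ⟨ J ⟩ y × LiftsLeft L a b x y
    LiftedBy⁻ = ⌊⌋ʳ⁻ (LiftedByStep? J a b)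

    LiftedBy-⊑ : LiftedBy J a b ⊑ J
    LiftedBy-⊑ _ _ = proj₁ ∘ LiftedBy⁻

    LiftedBy-lifts : LiftsAll L a b (LiftedBy J a b)
    LiftedBy-lifts _ _ = proj₂ ∘ LiftedBy⁻

    LiftedBy-isTransferSystem : IsTransferSystem L J → IsTransferSystem L (LiftedBy J a b)
    LiftedBy-isTransferSystem J-isTS = record
      { sub = λ x y → TS.sub J-isTS x y ∘ proj₁ ∘ LiftedBy⁻
      ; refl = λ x → LiftedBy⁺ (TS.refl J-isTS x) λ _ b≤x → b≤x
      ; trans = λ x y z xy yz →
          let (xJy , xy-lift) = LiftedBy⁻ xy
              (yJz , yz-lift) = LiftedBy⁻ yz
          in LiftedBy⁺ (TS.trans J-isTS x y z xJy yJz) λ a≤x b≤z →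
               xy-lift a≤x (yz-lift (≤-trans a≤x (TS.sub J-isTS x y xJy)) b≤z)
      ; restr = λ x y w xy w≤y →
          let (xJy , xy-lift) = LiftedBy⁻ xy
          in LiftedBy⁺ (TS.restr J-isTS x y w xJy w≤y) λ a≤x∧w b≤w →
               ∧-greatest (xy-lift (≤-trans a≤x∧w (x∧y≤x x w)) (≤-trans b≤w w≤y)) b≤w
      }

  module JoinIrreducibles (R₁ R : BRel L) (R₁-isTS : IsTransferSystem L R₁)
    (R-isTS : IsTransferSystem L R) (R₁⊑R : R₁ ⊑ R) where
    open Interval L R₁ R

    R₁-trans : ∀ {x y z} → x ⟨ R₁ ⟩ y → y ⟨ R₁ ⟩ z → x ⟨ R₁ ⟩ z
    R₁-trans = ⟨⟩-trans R₁-isTS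

    R₁∘Tr∘R₁ : Elt L → Elt L → Rel (Elt L) 0ℓ
    R₁∘Tr∘R₁ a b x y = ∃₂ λ u v → x ⟨ R₁ ⟩ u × u ⟨ Tr a b ⟩ v × v ⟨ R₁ ⟩ y

    R₁∘Tr∘R₁? : ∀ a b → Decidable (R₁∘Tr∘R₁ a b)
    R₁∘Tr∘R₁? a b x y =
      any? λ u → any? λ v → holds? R₁ x u ×-dec (holds? (Tr a b) u v ×-dec holds? R₁ v y)

    R₁∨Tr : Elt L → Elt L → BRel L
    R₁∨Tr a b = ⌊ R₁∘Tr∘R₁? a b ⌋ʳ

    module _ (a b : Elt L) where

      R₁∨Tr⁺ : ∀ {x y} → R₁∘Tr∘R₁ a b x y → x ⟨ R₁∨Tr a b ⟩ y
      R₁∨Tr⁺ = ⌊⌋ʳ⁺ (R₁∘Tr∘R₁? a b)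

      R₁∨Tr⁻ : ∀ {x y} → x ⟨ R₁∨Tr a b ⟩ y → R₁∘Tr∘R₁ a b x y
      R₁∨Tr⁻ = ⌊⌋ʳ⁻ (R₁∘Tr∘R₁? a b)

      R₁⊑R₁∨Tr : R₁ ⊑ R₁∨Tr a b
      R₁⊑R₁∨Tr x y xR₁y = R₁∨Tr⁺ (x , x , TS.refl R₁-isTS x , Tr⁺ a b (inj₁ refl) , xR₁y)

      R₁∨Tr-∋ : a ≤ b → a ⟨ R₁∨Tr a b ⟩ b
      R₁∨Tr-∋ a≤b = R₁∨Tr⁺ (a , b , TS.refl R₁-isTS a , Tr-∋ a b a≤b , TS.refl R₁-isTS b)

      R₁∨Tr-sub : ∀ x y → x ⟨ R₁∨Tr a b ⟩ y → x ≤ y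
      R₁∨Tr-sub x y xy = let (u , v , xu , uv , vy) = R₁∨Tr⁻ xy in
        ≤-trans (TS.sub R₁-isTS x u xu) (≤-trans (Tr-sub a b u v uv) (TS.sub R₁-isTS v y vy))

      -- Two non-trivial Tr(a,b)-steps never need to be chained: the R₁-path from the
      -- target v of the first to the source a ∧ v' of the second forces v ≤ a, so
      -- the first step is trivial.
      R₁∨Tr-trans : ∀ x y z → x ⟨ R₁∨Tr a b ⟩ y → y ⟨ R₁∨Tr a b ⟩ z → x ⟨ R₁∨Tr a b ⟩ z
      R₁∨Tr-trans x y z xy yz with R₁∨Tr⁻ xy | R₁∨Tr⁻ yz
      ... | u , v , xu , uv , vy | u' , v' , yu' , u'v' , v'z with Tr⁻ a b uv | Tr⁻ a b u'v'
      ... | inj₁ refl | _ = R₁∨Tr⁺ (u' , v' , R₁-trans (R₁-trans xu vy) yu' , u'v' , v'z)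
      ... | inj₂ _ | inj₁ refl = R₁∨Tr⁺ (u , v , xu , uv , R₁-trans vy (R₁-trans yu' v'z))
      ... | inj₂ (_ , refl) | inj₂ (_ , refl) =
        R₁∨Tr⁺ (u' , v' , R₁-trans (subst (x ⟨ R₁ ⟩_) a∧v≡v xu) vu' , u'v' , v'z)
        where
        vu' : v ⟨ R₁ ⟩ (a ∧ v')
        vu' = R₁-trans vy yu'
        a∧v≡v : a ∧ v ≡ v
        a∧v≡v = y≤x⇒x∧y≈y (≤-trans (TS.sub R₁-isTS _ _ vu') (x∧y≤x a v'))

      R₁∨Tr-restr : ∀ x y w → x ⟨ R₁∨Tr a b ⟩ y → w ≤ y → (x ∧ w) ⟨ R₁∨Tr a b ⟩ w
      R₁∨Tr-restr x y w xy w≤y = let (u , v , xu , uv , vy) = R₁∨Tr⁻ xy in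
        R₁∨Tr⁺ (u ∧ w , v ∧ w , restrict-∧ R₁-isTS w xu ,
                restrict-∧ (Tr-isTransferSystem a b) w uv , TS.restr R₁-isTS v y w vy w≤y)

      R₁∨Tr-isTransferSystem : IsTransferSystem L (R₁∨Tr a b)
      R₁∨Tr-isTransferSystem = record
        { sub = R₁∨Tr-sub
        ; refl = λ x → R₁⊑R₁∨Tr x x (TS.refl R₁-isTS x)
        ; trans = R₁∨Tr-trans
        ; restr = R₁∨Tr-restr
        }

      R₁∨Tr-least : ∀ {U} → IsTransferSystem L U → R₁ ⊑ U → a ⟨ U ⟩ b → R₁∨Tr a b ⊑ U
      R₁∨Tr-least U-isTS R₁⊑U aUb x y xy = let (u , v , xu , uv , vy) = R₁∨Tr⁻ xy in
        ⟨⟩-trans U-isTS (R₁⊑U x u xu)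
          (⟨⟩-trans U-isTS (Tr-minimal a b U-isTS aUb u v uv) (R₁⊑U v y vy))

      R₁∨Tr∈I : a ⟨ R ⟩ b → InI (R₁∨Tr a b)
      R₁∨Tr∈I aRb = R₁∨Tr-isTransferSystem , R₁⊑R₁∨Tr , R₁∨Tr-least R-isTS R₁⊑R aRb

      R₁∨Tr-lifting : LiftsAll L a b R₁ → ∀ {x y} → x ⟨ R₁∨Tr a b ⟩ y → a ≤ x → b ≤ y →
        b ≤ x ⊎ (x ≡ a × ∃ λ v → a ≤ v × v ≤ b × v ⟨ R₁ ⟩ y)
      R₁∨Tr-lifting lifts {x} {y} xy a≤x b≤y with R₁∨Tr⁻ xy
      ... | u , v , xu , uv , vy with Tr⁻ a b uv
      ... | inj₁ refl = inj₁ (lifts x y (R₁-trans xu vy) a≤x b≤y)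
      ... | inj₂ (v≤b , refl) =
        inj₂ (x≡a , v , ≤-trans a≤x (≤-trans x≤a∧v (x∧y≤y a v)) , v≤b , vy)
        where
        x≤a∧v : x ≤ (a ∧ v)
        x≤a∧v = TS.sub R₁-isTS _ _ xu
        x≡a : x ≡ a
        x≡a = antisym (≤-trans x≤a∧v (x∧y≤x a v)) a≤x

    module LabelCandidate {J : BRel L} (J∈I : InI J) {a b : Elt L}
      (candidate : IsLabelCandidate L R₁ J a b) where
      open LiftedByProperties J a b public

      J-isTS : IsTransferSystem L J
      J-isTS = proj₁ J∈I

      R₁⊑J : R₁ ⊑ J
      R₁⊑J = proj₁ (proj₂ J∈I)

      J⊑R : J ⊑ R
      J⊑R = proj₂ (proj₂ J∈I)

      aJb : a ⟨ J ⟩ b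
      aJb = proj₁ candidate

      a≢b : ¬ a ≡ b
      a≢b = proj₁ (proj₂ candidate)

      a,b-lifts-R₁ : LiftsAll L a b R₁
      a,b-lifts-R₁ = proj₂ (proj₂ candidate)

      a≤b : a ≤ b
      a≤b = TS.sub J-isTS a b aJb

      J₋ : BRel L
      J₋ = LiftedBy J a b

      R₁⊑J₋ : R₁ ⊑ J₋
      R₁⊑J₋ x y xR₁y = LiftedBy⁺ (R₁⊑J x y xR₁y) (a,b-lifts-R₁ x y xR₁y)

      J₋∈I : InI J₋
      J₋∈I = LiftedBy-isTransferSystem J-isTS , R₁⊑J₋ , (λ x y → J⊑R x y ∘ LiftedBy-⊑ x y)

      a∉J₋ : ¬ a ⟨ J₋ ⟩ b
      a∉J₋ = ¬self-lifting a≤b a≢b ∘ LiftedBy-lifts a b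

      J⋢J₋ : ¬ J ⊑ J₋
      J⋢J₋ J⊑J₋ = a∉J₋ (J⊑J₋ a b aJb)

    -- For J in the interval this already means J = R₁ ∨ Tr(a,b), see J≐R₁∨Tr.
    GeneratedBy : BRel L → Elt L → Elt L → Set
    GeneratedBy J a b = IsLabelCandidate L R₁ J a b × J ⊑ R₁∨Tr a b

    module Generated {J : BRel L} (J∈I : InI J) {a b : Elt L} (gen : GeneratedBy J a b) where
      open LabelCandidate J∈I (proj₁ gen) public

      J⊑R₁∨Tr : J ⊑ R₁∨Tr a b
      J⊑R₁∨Tr = proj₂ gen

      J≐R₁∨Tr : _≐_ L J (R₁∨Tr a b)
      J≐R₁∨Tr = J⊑R₁∨Tr , R₁∨Tr-least a b J-isTS R₁⊑J aJb

      J-least : ∀ {U} → IsTransferSystem L U → R₁ ⊑ U → a ⟨ U ⟩ b → J ⊑ U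
      J-least U-isTS R₁⊑U aUb x y = R₁∨Tr-least a b U-isTS R₁⊑U aUb x y ∘ J⊑R₁∨Tr x y

      ⊏J⇒⊑J₋ : ∀ {K} → InI K → K ⊑ J → ¬ J ⊑ K → K ⊑ J₋
      ⊏J⇒⊑J₋ {K} (K-isTS , R₁⊑K , _) K⊑J J⋢K x y xKy = LiftedBy⁺ (K⊑J x y xKy) lift
        where
        lift : LiftsLeft L a b x y
        lift a≤x b≤y with TS.restr K-isTS x y b xKy b≤y
        ... | x∧bKb with R₁∨Tr-lifting a b a,b-lifts-R₁ (J⊑R₁∨Tr _ _ (K⊑J _ _ x∧bKb))
                           (∧-greatest a≤x a≤b) ≤-refl
        ... | inj₁ b≤x∧b = ≤-trans b≤x∧b (x∧y≤x x b)
        ... | inj₂ (x∧b≡a , _) =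
          ⊥-elim (J⋢K (J-least K-isTS R₁⊑K (subst (_⟨ K ⟩ b) x∧b≡a x∧bKb)))

      J₋⋖J : Covers J₋ J
      J₋⋖J = J₋∈I , J∈I , LiftedBy-⊑ , J⋢J₋ , between
        where
        between : ∀ U → InI U → J₋ ⊑ U → U ⊑ J → _≐_ L U J₋ ⊎ _≐_ L U J
        between U U∈I J₋⊑U U⊑J with J ⊑? U
        ... | yes J⊑U = inj₂ (U⊑J , J⊑U)
        ... | no J⋢U = inj₁ (⊏J⇒⊑J₋ U∈I U⊑J J⋢U , J₋⊑U)

      J₋-uniqueCover : ∀ K → Covers K J → _≐_ L K J₋
      J₋-uniqueCover K (K∈I , _ , K⊑J , J⋢K , between) = K⊑J₋ , J₋⊑K
        where
        K⊑J₋ : K ⊑ J₋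
        K⊑J₋ = ⊏J⇒⊑J₋ K∈I K⊑J J⋢K
        J₋⊑K : J₋ ⊑ K
        J₋⊑K with between J₋ J₋∈I K⊑J₋ LiftedBy-⊑
        ... | inj₁ (J₋⊑K , _) = J₋⊑K
        ... | inj₂ (_ , J⊑J₋) = ⊥-elim (J⋢J₋ J⊑J₋)

      -- A candidate (c , d) is not lifted by itself, hence not by (a , b); the lifting
      -- lemma then gives c = a and an R₁-relation (v , d) with v ≤ b, which (a , d) lifts.
      joinLabel : IsJoinLabel L J₋ J a b
      joinLabel = (aJb , a≢b , LiftedBy-lifts) , unique
        where
        unique : ∀ c d → IsLabelCandidate L J₋ J c d → (c , d) ≡ (a , b)
        unique c d (cJd , c≢d , c,d-lifts-J₋) with LiftsLeft? a b c d
        ... | yes lift = ⊥-elim (¬self-lifting (TS.sub J-isTS c d cJd) c≢d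
                                  (c,d-lifts-J₋ c d (LiftedBy⁺ cJd lift)))
        ... | no ¬lift with ¬LiftsLeft⇒ ¬lift
        ... | a≤c , b≤d , b≰c with R₁∨Tr-lifting a b a,b-lifts-R₁ (J⊑R₁∨Tr c d cJd) a≤c b≤d
        ... | inj₁ b≤c = ⊥-elim (b≰c b≤c)
        ... | inj₂ (refl , v , a≤v , v≤b , vR₁d) = cong (a ,_) (antisym d≤b b≤d)
          where
          d≤b : d ≤ b
          d≤b = ≤-trans (c,d-lifts-J₋ v d (R₁⊑J₋ v d vR₁d) a≤v ≤-refl) v≤b

      J-isJoin : IsJoinTrs L R₁ (Tr a b) J
      J-isJoin = J-isTS , R₁⊑J , Tr-minimal a b J-isTS aJb
               , λ U U-isTS R₁⊑U Tr⊑U → J-least U-isTS R₁⊑U (Tr⊑U a b (Tr-∋ a b a≤b))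

      psiSpec : PsiSpec L R₁ R J a b
      psiSpec = (J⊑R a b aJb , a≢b , a,b-lifts-R₁)
              , (J₋ , J₋⋖J , J₋-uniqueCover , joinLabel , λ _ _ → LiftedBy⁻ , uncurry LiftedBy⁺)
              , (Tr a b , Tr-isTr a b a≤b , J-isJoin)

      joinIrreducible : JoinIrr J
      joinIrreducible = J∈I , (λ (J⊑R₁ , _) → a∉R₁ (J⊑R₁ a b aJb)) , irreducible
        where
        a∉R₁ : ¬ a ⟨ R₁ ⟩ b
        a∉R₁ = ¬self-lifting a≤b a≢b ∘ a,b-lifts-R₁ a b
        irreducible : ∀ S U → InI S → InI U → IsJoinI S U J → _≐_ L J S ⊎ _≐_ L J U
        irreducible S U S∈I U∈I (_ , S⊑J , U⊑J , least) with J ⊑? S | J ⊑? U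
        ... | yes J⊑S | _ = inj₁ (J⊑S , S⊑J)
        ... | no _ | yes J⊑U = inj₂ (J⊑U , U⊑J)
        ... | no J⋢S | no J⋢U =
          ⊥-elim (J⋢J₋ (least J₋ J₋∈I (⊏J⇒⊑J₋ S∈I S⊑J J⋢S) (⊏J⇒⊑J₋ U∈I U⊑J J⋢U)))

    -- Both generators are label candidates for the same cover J₋ ⋖ J.
    generator-unique : ∀ {J} → InI J → ∀ {a b c d} → GeneratedBy J a b → GeneratedBy J c d →
      (a , b) ≡ (c , d)
    generator-unique J∈I {c = c} {d} gen-ab gen-cd =
      sym (proj₂ Gab.joinLabel c d (Gcd.aJb , Gcd.a≢b , c,d-lifts-J₋))
      where
      module Gab = Generated J∈I gen-ab
      module Gcd = Generated J∈I gen-cd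
      c,d-lifts-J₋ : LiftsAll L c d Gab.J₋
      c,d-lifts-J₋ x y =
        Gcd.LiftedBy-lifts x y ∘ Gcd.⊏J⇒⊑J₋ Gab.J₋∈I Gab.LiftedBy-⊑ Gab.J⋢J₋ x y

    Candidate : BRel L → Elt L × Elt L → Set
    Candidate J (a , b) = IsLabelCandidate L R₁ J a b

    Candidate? : ∀ J p → Dec (Candidate J p)
    Candidate? J (a , b) = holds? J a b ×-dec (¬? (a ≟ b) ×-dec LiftsAll? a b R₁)

    _>_ : Rel (Elt L) 0ℓ
    _>_ = flip _<_

    _>?_ : Decidable _>_
    x >? y = (y ≤? x) ×-dec ¬? (y ≟ x)

    _>ₗₑₓ_ : Rel (Elt L × Elt L) 0ℓ
    _>ₗₑₓ_ = ×-Lex _≡_ _>_ _>_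

    >ₗₑₓ-wellFounded : WellFounded _>ₗₑₓ_
    >ₗₑₓ-wellFounded = ×-wellFounded (po-noetherian isPartialOrder) (po-noetherian isPartialOrder)

    candidate-above? : ∀ J p → Dec (∃ λ q → q >ₗₑₓ p × Candidate J q)
    candidate-above? J p = any²? λ q → ×-decidable _≟_ _>?_ _>?_ q p ×-dec Candidate? J q

    ⋢⇒candidate : ∀ {J U} → InI J → IsTransferSystem L U → R₁ ⊑ U → ¬ J ⊑ U →
      ∃₂ λ x y → Candidate J (x , y) × ¬ x ⟨ U ⟩ y
    ⋢⇒candidate (J-isTS , _) U-isTS R₁⊑U J⋢U with ⋢⇒counterexample J⋢U
    ... | _ , _ , xJy , ¬xUy with liftingCounterexample J-isTS U-isTS xJy ¬xUy
    ... | x , y , xJy , ¬xUy , x,y-lifts-U =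
      x , y , (xJy , ∉⇒≢ U-isTS ¬xUy , λ p q → x,y-lifts-U p q ∘ R₁⊑U p q) , ¬xUy

    candidate-escapes : ∀ {J U a b} → InI J → InI U → a ⟨ U ⟩ b → LiftedBy J a b ⊑ U →
      ¬ J ⊑ U → ∃ λ q → q >ₗₑₓ (a , b) × Candidate J q
    candidate-escapes {J} {U} {a} {b} J∈I (U-isTS , R₁⊑U , _) aUb J₋⊑U J⋢U
      with ⋢⇒candidate J∈I U-isTS R₁⊑U J⋢U
    ... | x , y , x,y-candidate@(xJy , _) , ¬xUy
      with ¬LiftsLeft⇒ (λ lift → ¬xUy (J₋⊑U x y (LiftedByProperties.LiftedBy⁺ J a b xJy lift)))
    ... | a≤x , b≤y , _ = (x , y) , above , x,y-candidate
      where
      above : (x , y) >ₗₑₓ (a , b)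
      above with a ≟ x
      ... | no a≢x = inj₁ (a≤x , a≢x)
      ... | yes refl = inj₂ (refl , b≤y , λ b≡y → ¬xUy (subst (a ⟨ U ⟩_) b≡y aUb))

    maximal⇒generates : ∀ {J a b} → JoinIrr J → Candidate J (a , b) →
      (∀ q → q >ₗₑₓ (a , b) → ¬ Candidate J q) → GeneratedBy J a b
    maximal⇒generates {J} {a} {b} (J∈I , _ , irreducible) candidate maximal =
      candidate , [ proj₁ , (λ (J⊑J₋ , _) → ⊥-elim (J⋢J₋ J⊑J₋)) ]′
                    (irreducible (R₁∨Tr a b) J₋ (R₁∨Tr∈I a b (J⊑R a b aJb)) J₋∈I isJoin)
      where
      open LabelCandidate J∈I candidate
      isJoin : IsJoinI (R₁∨Tr a b) J₋ J
      isJoin = J∈I , R₁∨Tr-least a b J-isTS R₁⊑J aJb , LiftedBy-⊑ , least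
        where
        least : ∀ U → InI U → R₁∨Tr a b ⊑ U → J₋ ⊑ U → J ⊑ U
        least U U∈I R₁∨Tr⊑U J₋⊑U with J ⊑? U
        ... | yes J⊑U = J⊑U
        ... | no J⋢U with candidate-escapes J∈I U∈I (R₁∨Tr⊑U a b (R₁∨Tr-∋ a b a≤b)) J₋⊑U J⋢U
        ... | q , q>ab , q-candidate = ⊥-elim (maximal q q>ab q-candidate)

    generator : ∀ {J} → JoinIrr J → ∃ λ p → GeneratedBy J (proj₁ p) (proj₂ p)
    generator jJ@(J∈I@(_ , R₁⊑J , _) , J≢R₁ , _)
      with ⋢⇒candidate J∈I R₁-isTS (λ _ _ h → h) (λ J⊑R₁ → J≢R₁ (J⊑R₁ , R₁⊑J))
    ... | x , y , x,y-candidate , _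
      with ∃-maximal >ₗₑₓ-wellFounded (candidate-above? _) x,y-candidate
    ... | m , m-candidate , m-maximal = m , maximal⇒generates jJ m-candidate m-maximal

    Ψ : (J : BRel L) → JoinIrr J → Elt L × Elt L
    Ψ J jJ = proj₁ (generator jJ)

    Ψ-generates : ∀ {J} (jJ : JoinIrr J) → GeneratedBy J (proj₁ (Ψ J jJ)) (proj₂ (Ψ J jJ))
    Ψ-generates jJ = proj₂ (generator jJ)

    Ψ-spec : (J : BRel L) (jJ : JoinIrr J) → PsiSpec L R₁ R J (proj₁ (Ψ J jJ)) (proj₂ (Ψ J jJ))
    Ψ-spec J jJ = Generated.psiSpec (proj₁ jJ) (Ψ-generates jJ)

    Ψ-resp-≐ : (J J' : BRel L) (jJ : JoinIrr J) (jJ' : JoinIrr J') → _≐_ L J J' → Ψ J jJ ≡ Ψ J' jJ'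
    Ψ-resp-≐ J J' jJ jJ' (J⊑J' , J'⊑J) = generator-unique (proj₁ jJ') gen' (Ψ-generates jJ')
      where
      gen' : GeneratedBy J' (proj₁ (Ψ J jJ)) (proj₂ (Ψ J jJ))
      gen' = let ((aJb , a≢b , lifts) , J⊑R₁∨Tr) = Ψ-generates jJ in
        (J⊑J' _ _ aJb , a≢b , lifts) , λ x y → J⊑R₁∨Tr x y ∘ J'⊑J x y

    Ψ≡⇒⊑ : ∀ {J J'} (jJ : JoinIrr J) (jJ' : JoinIrr J') → Ψ J jJ ≡ Ψ J' jJ' → J ⊑ J'
    Ψ≡⇒⊑ {J} {J'} jJ jJ' Ψ≡ x y =
      proj₂ (Generated.J≐R₁∨Tr (proj₁ jJ') (Ψ-generates jJ')) x y
      ∘ subst (λ p → x ⟨ R₁∨Tr (proj₁ p) (proj₂ p) ⟩ y) Ψ≡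
      ∘ proj₂ (Ψ-generates jJ) x y

    Ψ-injective : (J J' : BRel L) (jJ : JoinIrr J) (jJ' : JoinIrr J') → Ψ J jJ ≡ Ψ J' jJ' →
      _≐_ L J J'
    Ψ-injective J J' jJ jJ' Ψ≡ = Ψ≡⇒⊑ jJ jJ' Ψ≡ , Ψ≡⇒⊑ jJ' jJ (sym Ψ≡)

    Ψ-surjective : (a b : Elt L) → InTarget L R₁ R a b →
      Σ (BRel L) λ J → Σ (JoinIrr J) λ jJ → Ψ J jJ ≡ (a , b)
    Ψ-surjective a b (aRb , a≢b , a,b-lifts-R₁) =
      R₁∨Tr a b , G.joinIrreducible , generator-unique (R₁∨Tr∈I a b aRb) (Ψ-generates G.joinIrreducible) gen
      where
      gen : GeneratedBy (R₁∨Tr a b) a b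
      gen = (R₁∨Tr-∋ a b (TS.sub R-isTS a b aRb) , a≢b , a,b-lifts-R₁) , λ _ _ h → h
      module G = Generated (R₁∨Tr∈I a b aRb) gen

mainTheorem18 : (L : FiniteLattice) (R₁ R : BRel L)
    → IsTransferSystem L R₁ → IsTransferSystem L R → _⊆_ L R₁ R
    → Σ ((J : BRel L) → Interval.JoinIrr L R₁ R J → Σ (Elt L) (λ _ → Elt L)) λ Ψ →
         ((J : BRel L) (jJ : Interval.JoinIrr L R₁ R J) →
            PsiSpec L R₁ R J (proj₁ (Ψ J jJ)) (proj₂ (Ψ J jJ)))
         × ((J J' : BRel L) (jJ : Interval.JoinIrr L R₁ R J) (jJ' : Interval.JoinIrr L R₁ R J')
              → _≐_ L J J' → Ψ J jJ ≡ Ψ J' jJ')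
         × ((J J' : BRel L) (jJ : Interval.JoinIrr L R₁ R J) (jJ' : Interval.JoinIrr L R₁ R J')
              → Ψ J jJ ≡ Ψ J' jJ' → _≐_ L J J')
         × ((a b : Elt L) → InTarget L R₁ R a b
              → Σ (BRel L) λ J → Σ (Interval.JoinIrr L R₁ R J) λ jJ → Ψ J jJ ≡ (a , b))
mainTheorem18 L R₁ R R₁-isTS R-isTS R₁⊆R = Ψ , Ψ-spec , Ψ-resp-≐ , Ψ-injective , Ψ-surjective
  where open TransferSystems.JoinIrreducibles L R₁ R R₁-isTS R-isTS R₁⊆R
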